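{- Let $q\ge 2$ be an integer and let $w_1,\dots,w_n$ be positive integers with $\sum_{i=1}^n w_i=\Omega$ and greatest common divisor $1$. Then there exists an integer $K$ such that for every integer $k\ge K$ with $\frac{k\Omega}{q}\in\mathbb{N}$ there exist non-negative integers $u_j^i$ ($1\le i\le q$, $1\le j\le n$) with $$\sum_{j=1}^n u_j^i w_j=\frac{k\Omega}{q}\quad\text{for all }1\le i\le q,\qquad \sum_{i=1}^q u_j^i=k\quad\text{for all }1\le j\le n.$$ -}

module Defs where

open import Data.Nat using (ℕ; zero; suc; _+_)
open import Data.Nat.GCD using (gcd)
open import Data.Fin using (Fin; zero; suc)

sumFin : (n : ℕ) → (Fin n → ℕ) → ℕ
sumFin zero    f = 0
sumFin (suc n) f = f zero + sumFin n (λ i → f (suc i))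

gcdFin : (n : ℕ) → (Fin n → ℕ) → ℕ
gcdFin zero    f = 0
gcdFin (suc n) f = gcd (f zero) (gcdFin n (λ i → f (suc i)))

-- Since gcd w = 1, the numbers representable as Σ vⱼ wⱼ with vⱼ ∈ ℕ include two
-- consecutive integers a, a + 1, hence every s ≥ a², so there is a threshold F beyond
-- which every number is representable. For large k write m = kΩ/q as d·Ω + s with
-- F ≤ s < (F + 1)Ω and represent s by v; then tⱼ = d + vⱼ represents m and is nearly
-- constant. Rows 2, …, q all equal t, and the first row is forced by the column sums to
-- be k − (q − 1)tⱼ, which is nonnegative for large k and has weighted sum kΩ − (q − 1)m = m.
module Submission where

open import Defs
open import Data.Nat using (ℕ; zero; suc; _+_; _*_; _∸_; _≤_; _<_; NonZero; >-nonZero)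
open import Data.Nat.Properties
open import Data.Nat.DivMod using (_/_; _%_; m≡m%n+[m/n]*n; m%n<n; m*n/n≡m; /-monoˡ-≤)
open import Data.Nat.GCD using (gcd; gcd-GCD; module Bézout)
open import Data.Nat.Tactic.RingSolver using (solve-∀)
open import Data.Fin using (Fin; zero; suc)
open import Data.Vec.Functional using (_∷_)
open import Data.Product using (∃; ∃₂; Σ; _×_; _,_; uncurry)
open import Relation.Binary.PropositionalEquality
  using (_≡_; refl; sym; trans; cong; cong₂; subst; subst₂; module ≡-Reasoning)

sumFin-cong : ∀ n {f g : Fin n → ℕ} → (∀ j → f j ≡ g j) → sumFin n f ≡ sumFin n g
sumFin-cong zero    f≗g = refl
sumFin-cong (suc n) f≗g = cong₂ _+_ (f≗g zero) (sumFin-cong n (λ j → f≗g (suc j)))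

sumFin-+ : ∀ n (f g : Fin n → ℕ) → sumFin n (λ j → f j + g j) ≡ sumFin n f + sumFin n g
sumFin-+ zero    f g = refl
sumFin-+ (suc n) f g = begin
  f zero + g zero + sumFin n (λ j → f (suc j) + g (suc j))
    ≡⟨ cong (f zero + g zero +_) (sumFin-+ n (λ j → f (suc j)) (λ j → g (suc j))) ⟩
  f zero + g zero + (F + G)
    ≡⟨ +-comm-middle (f zero) (g zero) F G ⟩
  f zero + F + (g zero + G) ∎
  where
  open ≡-Reasoning
  F = sumFin n (λ j → f (suc j))
  G = sumFin n (λ j → g (suc j))
  +-comm-middle : ∀ a b c d → a + b + (c + d) ≡ a + c + (b + d)
  +-comm-middle = solve-∀

sumFin-*ˡ : ∀ n c (f : Fin n → ℕ) → sumFin n (λ j → c * f j) ≡ c * sumFin n f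
sumFin-*ˡ zero    c f = sym (*-zeroʳ c)
sumFin-*ˡ (suc n) c f =
  trans (cong (c * f zero +_) (sumFin-*ˡ n c (λ j → f (suc j))))
        (sym (*-distribˡ-+ c (f zero) _))

sumFin-const : ∀ n a → sumFin n (λ _ → a) ≡ n * a
sumFin-const zero    a = refl
sumFin-const (suc n) a = cong (a +_) (sumFin-const n a)

f≤sumFin : ∀ n (f : Fin n → ℕ) j → f j ≤ sumFin n f
f≤sumFin (suc n) f zero    = m≤m+n (f zero) _
f≤sumFin (suc n) f (suc j) = ≤-trans (f≤sumFin n (λ i → f (suc i)) j) (m≤n+m _ (f zero))

dot : ∀ n → (Fin n → ℕ) → (Fin n → ℕ) → ℕ
dot n v w = sumFin n (λ j → v j * w j)

dot-+ : ∀ n (v v′ w : Fin n → ℕ) → dot n (λ j → v j + v′ j) w ≡ dot n v w + dot n v′ w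
dot-+ n v v′ w =
  trans (sumFin-cong n (λ j → *-distribʳ-+ (w j) (v j) (v′ j))) (sumFin-+ n _ _)

dot-*ˡ : ∀ n c (v w : Fin n → ℕ) → dot n (λ j → c * v j) w ≡ c * dot n v w
dot-*ˡ n c v w = trans (sumFin-cong n (λ j → *-assoc c (v j) (w j))) (sumFin-*ˡ n c _)

dot-const : ∀ n c (w : Fin n → ℕ) → dot n (λ _ → c) w ≡ c * sumFin n w
dot-const n c w = sumFin-*ˡ n c w

v≤dot : ∀ n {w : Fin n → ℕ} → (∀ j → 0 < w j) → ∀ v j → v j ≤ dot n v w
v≤dot n {w} w>0 v j =
  ≤-trans (m≤m*n (v j) (w j) {{>-nonZero (w>0 j)}}) (f≤sumFin n (λ i → v i * w i) j)

Representable : ∀ n → (Fin n → ℕ) → ℕ → Set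
Representable n w s = ∃ λ (v : Fin n → ℕ) → dot n v w ≡ s

representable-0 : ∀ n (w : Fin n → ℕ) → Representable n w 0
representable-0 n w = (λ _ → 0) , trans (sumFin-const n 0) (*-zeroʳ n)

representable-+ : ∀ n (w : Fin n → ℕ) {a b} →
  Representable n w a → Representable n w b → Representable n w (a + b)
representable-+ n w (v , v≡a) (v′ , v′≡b) =
  (λ j → v j + v′ j) , trans (dot-+ n v v′ w) (cong₂ _+_ v≡a v′≡b)

representable-head : ∀ n (w : Fin (suc n) → ℕ) → Representable (suc n) w (w zero)
representable-head n w with representable-0 n (λ j → w (suc j))
... | zeros , zeros≡0 = (1 ∷ zeros) ,
  trans (cong₂ _+_ (*-identityˡ (w zero)) zeros≡0) (+-identityʳ (w zero))

representable-tail : ∀ n (w : Fin (suc n) → ℕ) {s} →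
  Representable n (λ j → w (suc j)) s → Representable (suc n) w s
representable-tail n w (v , v≡s) = (0 ∷ v) , v≡s

DifferenceOf : (ℕ → Set) → ℕ → Set
DifferenceOf P s = ∃ λ b → P (s + b) × P b

difference-mono : ∀ {P Q : ℕ → Set} → (∀ {s} → P s → Q s) →
  ∀ {s} → DifferenceOf P s → DifferenceOf Q s
difference-mono P⊆Q (b , Psb , Pb) = b , P⊆Q Psb , P⊆Q Pb

module AdditivelyClosed (P : ℕ → Set) (P-0 : P 0) (P-+ : ∀ {a b} → P a → P b → P (a + b)) where

  P-* : ∀ c {a} → P a → P (c * a)
  P-* zero    Pa = P-0
  P-* (suc c) Pa = P-+ Pa (P-* c Pa)

  difference-gcd : ∀ {a b} → P a → DifferenceOf P b → DifferenceOf P (gcd a b)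
  difference-gcd {a} {b} Pa (c , Pbc , Pc)
    with Bézout.identity (gcd-GCD a b)
  ... | Bézout.+- x y d+yb≡xa =
    y * (b + c) , subst P xa+yc≡d+y[b+c] (P-+ (P-* x Pa) (P-* y Pc)) , P-* y Pbc
    where
    open ≡-Reasoning
    d = gcd a b
    xa+yc≡d+y[b+c] : x * a + y * c ≡ d + y * (b + c)
    xa+yc≡d+y[b+c] = begin
      x * a + y * c       ≡⟨ cong (_+ y * c) (sym d+yb≡xa) ⟩
      d + y * b + y * c   ≡⟨ +-assoc d (y * b) (y * c) ⟩
      d + (y * b + y * c) ≡⟨ cong (d +_) (*-distribˡ-+ y b c) ⟨
      d + y * (b + c)     ∎
  ... | Bézout.-+ x y d+xa≡yb =
    x * a + y * c , subst P y[b+c]≡d+[xa+yc] (P-* y Pbc) , P-+ (P-* x Pa) (P-* y Pc)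
    where
    open ≡-Reasoning
    d = gcd a b
    y[b+c]≡d+[xa+yc] : y * (b + c) ≡ d + (x * a + y * c)
    y[b+c]≡d+[xa+yc] = begin
      y * (b + c)         ≡⟨ *-distribˡ-+ y b c ⟩
      y * b + y * c       ≡⟨ cong (_+ y * c) (sym d+xa≡yb) ⟩
      d + x * a + y * c   ≡⟨ +-assoc d (x * a) (y * c) ⟩
      d + (x * a + y * c) ∎

  consecutive⇒cofinite : ∀ a .{{_ : NonZero a}} → P a → P (suc a) → ∀ s → a * a ≤ s → P s
  consecutive⇒cofinite a Pa Pa+1 s a²≤s =
    subst P (sym s≡[t∸r]a+r[a+1]) (P-+ (P-* (t ∸ r) Pa) (P-* r Pa+1))
    where
    open ≡-Reasoning
    t = s / a
    r = s % a
    r≤t : r ≤ t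
    r≤t = ≤-trans (<⇒≤ (m%n<n s a)) (subst (_≤ t) (m*n/n≡m a a) (/-monoˡ-≤ a a²≤s))
    regroup : ∀ u r a → r + (u + r) * a ≡ u * a + r * suc a
    regroup = solve-∀
    s≡[t∸r]a+r[a+1] : s ≡ (t ∸ r) * a + r * suc a
    s≡[t∸r]a+r[a+1] = begin
      s                        ≡⟨ m≡m%n+[m/n]*n s a ⟩
      r + t * a                ≡⟨ cong (λ t′ → r + t′ * a) (m∸n+n≡m r≤t) ⟨
      r + (t ∸ r + r) * a      ≡⟨ regroup (t ∸ r) r a ⟩
      (t ∸ r) * a + r * suc a  ∎

  difference-1⇒cofinite : DifferenceOf P 1 → ∃ λ F → ∀ s → F ≤ s → P s
  difference-1⇒cofinite (b , Pb+1 , Pb) =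
    a * a , consecutive⇒cofinite a (P-+ Pb+1 Pb)
                                   (subst P (cong suc (+-suc b b)) (P-+ Pb+1 Pb+1))
    where
    a = suc b + b

representable-gcd : ∀ n (w : Fin n → ℕ) → DifferenceOf (Representable n w) (gcdFin n w)
representable-gcd zero    w = 0 , ((λ ()) , refl) , ((λ ()) , refl)
representable-gcd (suc n) w =
  difference-gcd (representable-head n w)
                 (difference-mono (representable-tail n w) (representable-gcd n (λ j → w (suc j))))
  where
  open AdditivelyClosed (Representable (suc n) w)
                        (representable-0 (suc n) w) (representable-+ (suc n) w)

gcd≡1⇒cofinite : ∀ n (w : Fin n → ℕ) → gcdFin n w ≡ 1 →
  ∃ λ F → ∀ s → F ≤ s → Representable n w s
gcd≡1⇒cofinite n w gcd≡1 =
  difference-1⇒cofinite (subst (DifferenceOf (Representable n w)) gcd≡1 (representable-gcd n w))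
  where open AdditivelyClosed (Representable n w) (representable-0 n w) (representable-+ n w)

divide-with-offset : ∀ {Ω} .{{_ : NonZero Ω}} e c m → (e + c) * Ω ≤ m →
  ∃₂ λ d s → m ≡ d * Ω + s × e ≤ d × c * Ω ≤ s × s < suc c * Ω
divide-with-offset {Ω} e c m [e+c]Ω≤m =
  a ∸ c , c * Ω + r , m≡[a∸c]Ω+s , e≤a∸c , m≤m+n (c * Ω) r ,
  subst (c * Ω + r <_) (+-comm (c * Ω) Ω) (+-monoʳ-< (c * Ω) (m%n<n m Ω))
  where
  open ≡-Reasoning
  a = m / Ω
  r = m % Ω
  e+c≤a : e + c ≤ a
  e+c≤a = subst (_≤ a) (m*n/n≡m (e + c) Ω) (/-monoˡ-≤ Ω [e+c]Ω≤m)
  e≤a∸c : e ≤ a ∸ c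
  e≤a∸c = subst (_≤ a ∸ c) (m+n∸n≡m e c) (∸-monoˡ-≤ c e+c≤a)
  regroup : ∀ r d c Ω → r + (d + c) * Ω ≡ d * Ω + (c * Ω + r)
  regroup = solve-∀
  m≡[a∸c]Ω+s : m ≡ (a ∸ c) * Ω + (c * Ω + r)
  m≡[a∸c]Ω+s = begin
    m                           ≡⟨ m≡m%n+[m/n]*n m Ω ⟩
    r + a * Ω                   ≡⟨ cong (λ a′ → r + a′ * Ω) (m∸n+n≡m (≤-trans (m≤n+m c e) e+c≤a)) ⟨
    r + (a ∸ c + c) * Ω         ≡⟨ regroup r (a ∸ c) c Ω ⟩
    (a ∸ c) * Ω + (c * Ω + r)   ∎

near-constant-representation : ∀ n (w : Fin n → ℕ) → (∀ j → 0 < w j) →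
  ∀ F → (∀ s → F ≤ s → Representable n w s) → .{{_ : NonZero (sumFin n w)}} →
  ∀ e m → (e + F) * sumFin n w ≤ m →
  ∃₂ λ d (t : Fin n → ℕ) → dot n t w ≡ m × d * sumFin n w ≤ m × e ≤ d ×
    (∀ j → t j ≤ d + suc F * sumFin n w)
near-constant-representation n w w>0 F cofinite e m [e+F]Ω≤m
  with divide-with-offset e F m [e+F]Ω≤m
... | d , s , m≡dΩ+s , e≤d , FΩ≤s , s<S with cofinite s (≤-trans (m≤m*n F (sumFin n w)) FΩ≤s)
... | v , v≡s =
  d , t , t≡m , subst (d * Ω ≤_) (sym m≡dΩ+s) (m≤m+n (d * Ω) s) , e≤d ,
  λ j → +-monoʳ-≤ d (≤-trans (v≤dot n w>0 v j) (subst (_≤ S) (sym v≡s) (<⇒≤ s<S)))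
  where
  Ω = sumFin n w
  S = suc F * Ω
  t = λ j → d + v j
  t≡m : dot n t w ≡ m
  t≡m = trans (dot-+ n (λ _ → d) v w) (trans (cong₂ _+_ (dot-const n d w) v≡s) (sym m≡dΩ+s))

aΩ≤m⇒qa≤k : ∀ q a {m k Ω} .{{_ : NonZero Ω}} → q * m ≡ k * Ω →
  a * Ω ≤ m → q * a ≤ k
aΩ≤m⇒qa≤k q a {m} {k} {Ω} qm≡kΩ aΩ≤m =
  *-cancelʳ-≤ (q * a) k Ω
    (subst₂ _≤_ (sym (*-assoc q a Ω)) qm≡kΩ (*-monoʳ-≤ q aΩ≤m))

qa≤k⇒aΩ≤m : ∀ q a {m k Ω} .{{_ : NonZero q}} → q * m ≡ k * Ω →
  q * a ≤ k → a * Ω ≤ m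
qa≤k⇒aΩ≤m q a {m} {k} {Ω} qm≡kΩ qa≤k =
  *-cancelˡ-≤ q (subst₂ _≤_ (*-assoc q a Ω) (sym qm≡kΩ) (*-monoˡ-≤ Ω qa≤k))

pS≤d⇒p[d+S]≤[1+p]d : ∀ p d S → p * S ≤ d → p * (d + S) ≤ suc p * d
pS≤d⇒p[d+S]≤[1+p]d p d S pS≤d = begin
  p * (d + S)    ≡⟨ *-distribˡ-+ p d S ⟩
  p * d + p * S  ≤⟨ +-monoʳ-≤ (p * d) pS≤d ⟩
  p * d + d      ≡⟨ +-comm (p * d) d ⟩
  suc p * d      ∎
  where open ≤-Reasoning

fill-first-row : ∀ p n (w : Fin n → ℕ) k m (t : Fin n → ℕ) →
  dot n t w ≡ m → suc p * m ≡ k * sumFin n w → (∀ j → p * t j ≤ k) →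
  Σ (Fin (suc p) → Fin n → ℕ) λ u →
    (∀ i → dot n (u i) w ≡ m) × (∀ j → sumFin (suc p) (λ i → u i j) ≡ k)
fill-first-row p n w k m t t≡m qm≡kΩ pt≤k = (first ∷ λ _ → t) , rows , columns
  where
  open ≡-Reasoning
  first : Fin n → ℕ
  first j = k ∸ p * t j
  first+pt≡k : ∀ j → first j + p * t j ≡ k
  first+pt≡k j = m∸n+n≡m (pt≤k j)
  first≡m : dot n first w ≡ m
  first≡m = +-cancelʳ-≡ (p * m) _ _ (begin
    dot n first w + p * m                       ≡⟨ cong (dot n first w +_) (cong (p *_) t≡m) ⟨
    dot n first w + p * dot n t w               ≡⟨ cong (dot n first w +_) (dot-*ˡ n p t w) ⟨
    dot n first w + dot n (λ j → p * t j) w     ≡⟨ dot-+ n first (λ j → p * t j) w ⟨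
    dot n (λ j → first j + p * t j) w           ≡⟨ sumFin-cong n (λ j → cong (_* w j) (first+pt≡k j)) ⟩
    dot n (λ _ → k) w                           ≡⟨ dot-const n k w ⟩
    k * sumFin n w                              ≡⟨ qm≡kΩ ⟨
    m + p * m                                   ∎)
  rows : ∀ i → dot n ((first ∷ λ _ → t) i) w ≡ m
  rows zero    = first≡m
  rows (suc i) = t≡m
  columns : ∀ j → first j + sumFin p (λ _ → t j) ≡ k
  columns j = trans (cong (first j +_) (sumFin-const p (t j))) (first+pt≡k j)

eventually-balanced-tables : ∀ p n (w : Fin n → ℕ) → (∀ j → 0 < w j) →
  .{{_ : NonZero (sumFin n w)}} → ∀ F → (∀ s → F ≤ s → Representable n w s) →
  ∃ λ K → ∀ k → K ≤ k → ∀ m → suc p * m ≡ k * sumFin n w →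
    Σ (Fin (suc p) → Fin n → ℕ) λ u →
      (∀ i → dot n (u i) w ≡ m) × (∀ j → sumFin (suc p) (λ i → u i j) ≡ k)
eventually-balanced-tables p n w w>0 F cofinite = suc p * (p * S + F) , tables
  where
  Ω = sumFin n w
  S = suc F * Ω
  tables : ∀ k → suc p * (p * S + F) ≤ k → ∀ m → suc p * m ≡ k * Ω →
    Σ (Fin (suc p) → Fin n → ℕ) λ u →
      (∀ i → dot n (u i) w ≡ m) × (∀ j → sumFin (suc p) (λ i → u i j) ≡ k)
  tables k K≤k m qm≡kΩ
    with near-constant-representation n w w>0 F cofinite (p * S) m
           (qa≤k⇒aΩ≤m (suc p) (p * S + F) qm≡kΩ K≤k)
  ... | d , t , t≡m , dΩ≤m , pS≤d , t≤d+S =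
    fill-first-row p n w k m t t≡m qm≡kΩ λ j →
      ≤-trans (*-monoʳ-≤ p (t≤d+S j))
              (≤-trans (pS≤d⇒p[d+S]≤[1+p]d p d S pS≤d)
                       (aΩ≤m⇒qa≤k (suc p) d qm≡kΩ dΩ≤m))

lemma4 : (q : ℕ) → 2 ≤ q → (n : ℕ) → (w : Fin n → ℕ) → (∀ j → 0 < w j) → gcdFin n w ≡ 1 →
    ∃ λ (K : ℕ) → ∀ (k : ℕ) → K ≤ k → (m : ℕ) → q * m ≡ k * sumFin n w →
      Σ (Fin q → Fin n → ℕ) λ u →
        (∀ (i : Fin q) → sumFin n (λ j → u i j * w j) ≡ m) ×
        (∀ (j : Fin n) → sumFin q (λ i → u i j) ≡ k)
-- The hypothesis 2 ≤ q is only used to exclude q = 0.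
lemma4 (suc p) _ zero    w w>0 ()
lemma4 (suc p) _ (suc n) w w>0 gcd≡1 =
  uncurry (eventually-balanced-tables p (suc n) w w>0) (gcd≡1⇒cofinite (suc n) w gcd≡1)
  where
  instance
    Ω≢0 : NonZero (sumFin (suc n) w)
    Ω≢0 = >-nonZero (≤-trans (w>0 zero) (m≤m+n (w zero) _))
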